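{- Let $G$ be a graph, $\mathcal{P}$ a maximal $P_2$-packing of $G$ of size $j$, suppose $G$ has a $P_2$-packing of size $j+1$, and let $\mathcal{Q}\in\mathfrak{Q}_{(2)}$. Let $p\in\mathcal{P}$ with $|V(p)\cap V(\mathcal{Q})|=2$ such that neither of the two vertices of $V(p)\cap V(\mathcal{Q})$ is a $\mathcal{Q}$-endpoint. Then one of the paths of $\mathcal{Q}$ containing a vertex of $V(p)$ is foldable.
   Context: A $P_2$ is a path $p=p_1p_2p_3$ (three vertices, edges $p_1p_2,p_2p_3$; the roles of $p_1,p_3$ may be interchanged). A $P_2$-packing is a set of pairwise vertex-disjoint $P_2$'s in $G$, maximal if no further $P_2$ vertex-disjoint from all members can be added. $V(\cdot)$, $E(\cdot)$ denote vertex/edge sets (unions for sets of paths). $\mathfrak{Q}_{(1)}$ is the set of $P_2$-packings $\mathcal{Q}$ of size $j+1$ maximizing $\sum_{p\in\mathcal{P}}\sum_{q\in\mathcal{Q}}1_{[E(p)=E(q)]}$; $\mathfrak{Q}_{(2)}$ is the set of those $\mathcal{Q}\in\mathfrak{Q}_{(1)}$ maximizing $\sum_{p\in\mathcal{P}}\sum_{q\in\mathcal{Q}}|E(p)\cap E(q)|$. A vertex $v$ is a $\mathcal{Q}$-endpoint if there is a (unique) $q=q_1q_2q_3\in\mathcal{Q}$ with $v=q_1$ or $v=q_3$; it is a $\mathcal{Q}$-midpoint if $v=q_2$ for some $q\in\mathcal{Q}$. A path $q=q_1q_2q_3\in\mathcal{Q}$ is foldable (on $p=p_1p_2p_3\in\mathcal{P}$)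 if $q_2\in V(p)\cap V(q)$ and, writing $p_s=q_2$, either $p_{s+1}$ exists and $p_{s+1}\notin V(\mathcal{Q})$, or $p_{s-1}$ exists and $p_{s-1}\notin V(\mathcal{Q})$. -}

module Defs where

open import Data.Nat using (ℕ; zero; suc; _+_; _≤_)
open import Data.Fin using (Fin; _≟_)
open import Data.Bool using (Bool; true; false; if_then_else_; _∧_; _∨_)
open import Data.List using (List; map; length)
open import Data.Nat.ListAction using (sum)
open import Data.Bool.ListAction using (any)
open import Data.List.Membership.Propositional using (_∈_)
open import Data.List.Relation.Unary.Any using (Any)
open import Data.List.Relation.Unary.AllPairs using (AllPairs)
open import Data.Product using (Σ; _×_; ∃; ∃-syntax; _,_)
open import Data.Sum using (_⊎_)
open import Data.Empty using (⊥)
open import Relation.Nullary using (¬_; does)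
open import Relation.Binary.PropositionalEquality using (_≡_)

record Graph : Set₁ where
  field
    n     : ℕ
    Adj   : Fin n → Fin n → Set
    sym   : ∀ {u v} → Adj u v → Adj v u
    irref : ∀ {u} → ¬ Adj u u

module _ (G : Graph) where
  open Graph G

  record P2 : Set where
    constructor mkP2
    field
      v1 v2 v3 : Fin n
      e12 : Adj v1 v2
      e23 : Adj v2 v3
      d13 : ¬ v1 ≡ v3
  open P2 public

  OnP : Fin n → P2 → Set
  OnP v p = (v ≡ v1 p) ⊎ (v ≡ v2 p) ⊎ (v ≡ v3 p)

  InV : List P2 → Fin n → Set
  InV Q v = Any (OnP v) Q

  VertexDisjoint : P2 → P2 → Set
  VertexDisjoint p q = ∀ v → OnP v p → OnP v q → ⊥

  -- A P₂-packing: pairwise vertex-disjoint P₂'s (a list; distinct entries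
  -- are automatically guaranteed by disjointness).
  IsPacking : List P2 → Set
  IsPacking Q = AllPairs VertexDisjoint Q

  IsMaximalPacking : List P2 → Set
  IsMaximalPacking Q = IsPacking Q × (∀ (q : P2) → ¬ (∀ p → p ∈ Q → VertexDisjoint p q))

  sameEdge : Fin n → Fin n → Fin n → Fin n → Bool
  sameEdge a b c d = (does (a ≟ c) ∧ does (b ≟ d)) ∨ (does (a ≟ d) ∧ does (b ≟ c))

  edgeIn : Fin n → Fin n → P2 → Bool
  edgeIn a b q = sameEdge a b (v1 q) (v2 q) ∨ sameEdge a b (v2 q) (v3 q)

  -- indicator 1[E(p) = E(q)]
  sameEdges : P2 → P2 → ℕ
  sameEdges p q =
    if edgeIn (v1 p) (v2 p) q ∧ edgeIn (v2 p) (v3 p) q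
       ∧ edgeIn (v1 q) (v2 q) p ∧ edgeIn (v2 q) (v3 q) p
    then 1 else 0

  -- |E(p) ∩ E(q)|  (the two edges of p are distinct since p₁ ≠ p₃)
  commonEdges : P2 → P2 → ℕ
  commonEdges p q = (if edgeIn (v1 p) (v2 p) q then 1 else 0)
                  + (if edgeIn (v2 p) (v3 p) q then 1 else 0)

  pairSum : (P2 → P2 → ℕ) → List P2 → List P2 → ℕ
  pairSum f P Q = sum (map (λ p → sum (map (λ q → f p q) Q)) P)

  score1 : List P2 → List P2 → ℕ
  score1 = pairSum sameEdges

  score2 : List P2 → List P2 → ℕ
  score2 = pairSum commonEdges

  InQ1 : List P2 → ℕ → List P2 → Set
  InQ1 P j Q = IsPacking Q × length Q ≡ suc j
    × (∀ Q' → IsPacking Q' → length Q' ≡ suc j → score1 P Q' ≤ score1 P Q)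

  InQ2 : List P2 → ℕ → List P2 → Set
  InQ2 P j Q = InQ1 P j Q
    × (∀ Q' → InQ1 P j Q' → score2 P Q' ≤ score2 P Q)

  Endpoint : List P2 → Fin n → Set
  Endpoint Q v = Any (λ q → (v ≡ v1 q) ⊎ (v ≡ v3 q)) Q

  -- |V(p) ∩ V(𝒬)|  (vertices of p are distinct)
  inVb : List P2 → Fin n → Bool
  inVb Q v = any (λ q → does (v ≟ v1 q) ∨ does (v ≟ v2 q) ∨ does (v ≟ v3 q)) Q

  countInV : P2 → List P2 → ℕ
  countInV p Q = (if inVb Q (v1 p) then 1 else 0)
               + (if inVb Q (v2 p) then 1 else 0)
               + (if inVb Q (v3 p) then 1 else 0)

  FoldableOn : List P2 → P2 → P2 → Set
  FoldableOn Q q p =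
      (v2 q ≡ v1 p × ¬ InV Q (v2 p))
    ⊎ (v2 q ≡ v2 p × (¬ InV Q (v1 p) ⊎ ¬ InV Q (v3 p)))
    ⊎ (v2 q ≡ v3 p × ¬ InV Q (v2 p))

  Foldable : List P2 → List P2 → P2 → Set
  Foldable P Q q = ∃[ p ] (p ∈ P × FoldableOn Q q p)

module Submission where

-- A vertex of V(𝒬) that is not a 𝒬-endpoint is the
-- midpoint of some q ∈ 𝒬, so each of the two occupied vertices of p is a
-- 𝒬-midpoint.  The occupied pair is {p₁,p₂}, {p₂,p₃} or {p₁,p₃}:
--   * if p₂ is occupied, the path with midpoint p₂ is foldable on p, since
--     the remaining end p₁ or p₃ lies outside V(𝒬);
--   * otherwise p₁ is occupied and p₂ is free.

open import Defs
open import Data.Nat using (ℕ; suc; _+_)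
open import Data.Fin using (_≟_)
open import Data.Bool using (if_then_else_; _∨_)
open import Data.List using (List; length; []; _∷_)
open import Data.List.Membership.Propositional using (_∈_; find; lose)
open import Data.List.Relation.Unary.Any using (any?)
open import Data.Product using (_×_; ∃-syntax; _,_)
open import Data.Sum using (_⊎_; inj₁; inj₂)
open import Data.Empty using (⊥-elim)
open import Relation.Nullary using (¬_; Dec; yes; no; does)
open import Relation.Nullary.Decidable using (_⊎-dec_)
open import Relation.Binary.PropositionalEquality using (_≡_; refl; sym; trans; cong)

holdCount : ∀ {a b c} {A : Set a} {B : Set b} {C : Set c} →
            Dec A → Dec B → Dec C → ℕ
holdCount a? b? c? = (if does a? then 1 else 0)
                   + (if does b? then 1 else 0)
                   + (if does c? then 1 else 0)

exactlyTwo : ∀ {a b c} {A : Set a} {B : Set b} {C : Set c}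
             (a? : Dec A) (b? : Dec B) (c? : Dec C) → holdCount a? b? c? ≡ 2 →
             (A × B × ¬ C) ⊎ (¬ A × B × C) ⊎ (A × ¬ B × C)
exactlyTwo (yes a) (yes b) (no ¬c)  _ = inj₁ (a , b , ¬c)
exactlyTwo (no ¬a) (yes b) (yes c)  _ = inj₂ (inj₁ (¬a , b , c))
exactlyTwo (yes a) (no ¬b) (yes c)  _ = inj₂ (inj₂ (a , ¬b , c))
exactlyTwo (yes _) (yes _) (yes _) ()
exactlyTwo (yes _) (no _)  (no _)  ()
exactlyTwo (no _)  (yes _) (no _)  ()
exactlyTwo (no _)  (no _)  (yes _) ()
exactlyTwo (no _)  (no _)  (no _)  ()

module _ (G : Graph) where

  onP? : ∀ v q → Dec (OnP G v q)
  onP? v q = v ≟ v1 q ⊎-dec v ≟ v2 q ⊎-dec v ≟ v3 q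

  inV? : ∀ Q v → Dec (InV G Q v)
  inV? Q v = any? (onP? v) Q

  inVb-does : ∀ Q v → inVb G Q v ≡ does (inV? Q v)
  inVb-does []      v = refl
  inVb-does (q ∷ Q) v = cong (does (onP? v q) ∨_) (inVb-does Q v)

  countInV-holdCount : ∀ p Q →
    countInV G p Q ≡ holdCount (inV? Q (v1 p)) (inV? Q (v2 p)) (inV? Q (v3 p))
  countInV-holdCount p Q
    rewrite inVb-does Q (v1 p) | inVb-does Q (v2 p) | inVb-does Q (v3 p) = refl

  midpointOf : ∀ Q v → InV G Q v → ¬ Endpoint G Q v → ∃[ q ] (q ∈ Q × v2 q ≡ v)
  midpointOf Q v v∈Q notEnd with find v∈Q
  ... | q , q∈Q , inj₁ v≡q₁         = ⊥-elim (notEnd (lose q∈Q (inj₁ v≡q₁)))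
  ... | q , q∈Q , inj₂ (inj₁ v≡q₂) = q , q∈Q , sym v≡q₂
  ... | q , q∈Q , inj₂ (inj₂ v≡q₃) = ⊥-elim (notEnd (lose q∈Q (inj₂ v≡q₃)))

  foldableAt : ∀ P Q p → p ∈ P → ∀ v → OnP G v p → InV G Q v → ¬ Endpoint G Q v →
               (∀ {q : P2 G} → v2 q ≡ v → FoldableOn G Q q p) →
               ∃[ q ] (q ∈ Q × (∃[ w ] (OnP G w p × OnP G w q)) × Foldable G P Q q)
  foldableAt P Q p p∈P v v∈p v∈Q notEnd folds with midpointOf Q v v∈Q notEnd
  ... | q , q∈Q , q₂≡v =
    q , q∈Q , (v , v∈p , inj₂ (inj₁ (sym q₂≡v))) , p , p∈P , folds {q} q₂≡v

lemma8 : (G : Graph) (j : ℕ) (P : List (P2 G)) →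
    IsMaximalPacking G P → length P ≡ j →
    (∃[ Q₀ ] (IsPacking G Q₀ × length Q₀ ≡ suc j)) →
    (Q : List (P2 G)) → InQ2 G P j Q →
    (p : P2 G) → p ∈ P → countInV G p Q ≡ 2 →
    (∀ v → OnP G v p → InV G Q v → ¬ Endpoint G Q v) →
    ∃[ q ] (q ∈ Q × (∃[ v ] (OnP G v p × OnP G v q)) × Foldable G P Q q)
lemma8 G j P _ _ _ Q _ p p∈P two noEndpoint =
  byCases (exactlyTwo (inV? G Q (v1 p)) (inV? G Q (v2 p)) (inV? G Q (v3 p))
                      (trans (sym (countInV-holdCount G p Q)) two))
  where
  Goal : Set
  Goal = ∃[ q ] (q ∈ Q × (∃[ v ] (OnP G v p × OnP G v q)) × Foldable G P Q q)

  foldable : ∀ v → OnP G v p → InV G Q v →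
             (∀ {q : P2 G} → v2 q ≡ v → FoldableOn G Q q p) → Goal
  foldable v v∈p v∈Q = foldableAt G P Q p p∈P v v∈p v∈Q (noEndpoint v v∈p v∈Q)

  -- p₂ occupied: its 𝒬-path is foldable at the free end; otherwise the
  -- 𝒬-path through p₁ is foldable towards the free p₂.
  byCases : (InV G Q (v1 p) × InV G Q (v2 p) × ¬ InV G Q (v3 p))
          ⊎ (¬ InV G Q (v1 p) × InV G Q (v2 p) × InV G Q (v3 p))
          ⊎ (InV G Q (v1 p) × ¬ InV G Q (v2 p) × InV G Q (v3 p)) → Goal
  byCases (inj₁ (_ , p₂∈Q , p₃∉Q)) =
    foldable (v2 p) (inj₂ (inj₁ refl)) p₂∈Q
             (λ q₂≡p₂ → inj₂ (inj₁ (q₂≡p₂ , inj₂ p₃∉Q)))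
  byCases (inj₂ (inj₁ (p₁∉Q , p₂∈Q , _))) =
    foldable (v2 p) (inj₂ (inj₁ refl)) p₂∈Q
             (λ q₂≡p₂ → inj₂ (inj₁ (q₂≡p₂ , inj₁ p₁∉Q)))
  byCases (inj₂ (inj₂ (p₁∈Q , p₂∉Q , _))) =
    foldable (v1 p) (inj₁ refl) p₁∈Q (λ q₂≡p₁ → inj₁ (q₂≡p₁ , p₂∉Q))
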